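{- Run algorithm $\mathrm{Square}$ (defined in the context) on requests $r_1,\dots,r_N$. Let $r_i,r_j$ be two uncovered requests with $i>j$ such that $Q(i)$ and $Q(j)$ are not edge disjoint. Then (P1) $\rho(i)\ge 4\rho(j)$, and (P2) $v_j-\rho(j)\le v_i<u_j\le v_j$.
   Context: Time-line graph: nodes $0,1,\dots,n$ of a directed line; replicas $(v,t)$, $t\in\{0,1,2,\dots\}$; horizontal edges $((u,t),(u+1,t))$ and arcs $((v,t),(v,t+1))$. Requests $r_i=(v_i,t_i)$, $i=1,\dots,N$, with $0\le t_1\le\dots\le t_N$. $d_\infty((u,s),(v,t))=\max\{t-s,v-u\}$ if $s\le t,u\le v$, else $\infty$. Algorithm $\mathrm{Square}$: start with $F=\{(0,0)\}$, $t_0=0$. For $i=1,\dots,N$: (SQ1) add arcs from $(0,t_{i-1})$ to $(0,t_i)$; (SQ2) $\rho(i)=\min\{d_\infty(q,r_i): q\text{ a replica of }F\}$; (SQ3) among replicas of $F$ in $[v_i-5\rho(i),v_i]\times[t_i-5\rho(i),t_i]$ choose $q_i=(u_i,s_i)$ with $u_i$ minimal (ties arbitrary); (SQ4) add arcs from $(u_i,s_i)$ to $(u_i,t_i)$ and horizontal edges from $(u_i,t_i)$ to $(v_i,t_i)$; (SQ5) add arcs from $(u_i,t_i)$ to $(u_i,t_i+4\rho(i))$. Request $r_i$ is covered if $v_i-u_i\ge\rho(i)$, uncovered otherwise. Quarter-ball $Q(i)$: the subgraph of the time-line graph consisting of replicas $(u,s)$ with $u\le v_i$, $s\le t_i$,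 $(v_i-u)+(t_i-s)\le\rho(i)$ (those with a directed path of length at most $\rho(i)$ to $r_i$), with the edges between them. -}

module Defs where

open import Data.Nat using (ℕ; zero; suc; _+_; _*_; _∸_; _≤_; _<_; _⊔_)
open import Data.Product using (Σ; _×_; _,_)
open import Data.Sum using (_⊎_)
open import Data.Empty using (⊥)
open import Data.List using (List; []; _∷_; _++_)
open import Data.List.Relation.Unary.Any using (Any)
open import Relation.Binary.PropositionalEquality using (_≡_)

-- A replica (u , s) : node u, time s.
Replica : Set
Replica = ℕ × ℕ

data Edge : Set where
  H : ℕ → ℕ → Edge
  V : ℕ → ℕ → Edge

tailE : Edge → Replica
tailE (H x y) = x , y
tailE (V x y) = x , y

headE : Edge → Replica
headE (H x y) = suc x , y
headE (V x y) = x , suc y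

data Seg : Set where
  vert  : ℕ → ℕ → ℕ → Seg
  horiz : ℕ → ℕ → ℕ → Seg

EdgeIn : Edge → Seg → Set
EdgeIn (V x y) (vert u a b)  = x ≡ u × a ≤ y × y < b
EdgeIn (V x y) (horiz c a b) = ⊥
EdgeIn (H x y) (vert u a b)  = ⊥
EdgeIn (H x y) (horiz c a b) = y ≡ c × a ≤ x × x < b

-- F is represented by the list of blocks added so far (plus the initial vertex (0,0)).
-- q is a replica of F iff q = (0,0) or q is an endpoint of an edge of F.
InF : List Seg → Replica → Set
InF L q = (q ≡ (0 , 0)) ⊎
          Σ Edge (λ e → Any (EdgeIn e) L × ((tailE e ≡ q) ⊎ (headE e ≡ q)))

-- d∞ ((u,s),(v,t)) = k  (finite case: s ≤ t, u ≤ v, k = max{t-s, v-u})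
Dist∞ : Replica → Replica → ℕ → Set
Dist∞ (u , s) (v , t) k = u ≤ v × s ≤ t × k ≡ (t ∸ s) ⊔ (v ∸ u)

-- Steps are indexed 0-based: step k handles request r_{k+1} = (v k , t k).
-- Algorithm choices: ρ k, and q_{k+1} = (u k , s k).
prevT : (t : ℕ → ℕ) → ℕ → ℕ
prevT t zero    = 0
prevT t (suc k) = t k

sq1 : (t : ℕ → ℕ) → ℕ → Seg
sq1 t k = vert 0 (prevT t k) (t k)

-- all blocks added in step k (SQ1, SQ4, SQ5)
stepSegs : (v t u s ρ : ℕ → ℕ) → ℕ → List Seg
stepSegs v t u s ρ k =
  sq1 t k ∷ vert (u k) (s k) (t k) ∷ horiz (t k) (u k) (v k)
    ∷ vert (u k) (t k) (t k + 4 * ρ k) ∷ []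

Fpre : (v t u s ρ : ℕ → ℕ) → ℕ → List Seg
Fpre v t u s ρ zero    = []
Fpre v t u s ρ (suc k) = Fpre v t u s ρ k ++ stepSegs v t u s ρ k

-- F after SQ1 of step k (the F used in SQ2, SQ3 of step k)
Fmid : (v t u s ρ : ℕ → ℕ) → ℕ → List Seg
Fmid v t u s ρ k = Fpre v t u s ρ k ++ (sq1 t k ∷ [])

-- replica (x , y) lies in [vk - 5ρ, vk] × [tk - 5ρ, tk]  (integer box, stated without truncation)
InBox : ℕ → ℕ → ℕ → Replica → Set
InBox vk tk ρ (x , y) = vk ≤ x + 5 * ρ × x ≤ vk × tk ≤ y + 5 * ρ × y ≤ tk

ValidStep : (v t u s ρ : ℕ → ℕ) → ℕ → Set
ValidStep v t u s ρ k =
  (Σ Replica (λ q → InF F q × Dist∞ q r (ρ k))) ×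
  (∀ q d → InF F q → Dist∞ q r d → ρ k ≤ d) ×
  InF F (u k , s k) × InBox (v k) (t k) (ρ k) (u k , s k) ×
  (∀ x y → InF F (x , y) → InBox (v k) (t k) (ρ k) (x , y) → u k ≤ x)
  where
    F = Fmid v t u s ρ k
    r = (v k , t k)

ValidRun : (N : ℕ) (v t u s ρ : ℕ → ℕ) → Set
ValidRun N v t u s ρ = ∀ k → k < N → ValidStep v t u s ρ k

Uncovered : (v u ρ : ℕ → ℕ) → ℕ → Set
Uncovered v u ρ k = v k ∸ u k < ρ k

InQ : (v t ρ : ℕ → ℕ) → ℕ → Replica → Set
InQ v t ρ k (x , y) = x ≤ v k × y ≤ t k × (v k ∸ x) + (t k ∸ y) ≤ ρ k

EdgeInQ : (v t ρ : ℕ → ℕ) → ℕ → Edge → Set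
EdgeInQ v t ρ k e = InQ v t ρ k (tailE e) × InQ v t ρ k (headE e)

QNotEdgeDisjoint : (v t ρ : ℕ → ℕ) → ℕ → ℕ → Set
QNotEdgeDisjoint v t ρ i j = Σ Edge (λ e → EdgeInQ v t ρ i e × EdgeInQ v t ρ j e)

-- Two facts drive the argument.  ρ(i) is the ∞-distance from r_i to the nearest replica of F,
-- so no replica of F may lie in the window (v_i - ρ(i), v_i] × (t_i - ρ(i), t_i]; and a shared
-- edge of Q(i) and Q(j) places r_j close to r_i.  If u_j ≤ v_i, the row that step j drew at
-- time t_j would enter that window, hence v_i < u_j.  If ρ(i) < 4ρ(j), the replica q of F nearest
-- to r_i must lie left of u_j and below t_j: replicas added after step j either lie at times ≥ t_j
-- or on a column reaching time t_j, which again enters the window.  So q was already a replica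
-- when step j chose u_j, and it lies in the 5ρ(j)-box of r_j, contradicting the minimality of u_j.
module Submission where

open import Defs
open import Data.Nat using (ℕ; zero; suc; _+_; _*_; _∸_; _≤_; _<_; _⊓_; z≤n; s≤s)
open import Data.Nat.Properties
open import Data.Product using (Σ; ∃; _×_; _,_; proj₂)
open import Data.Sum using (_⊎_; inj₁; inj₂)
open import Data.Empty using (⊥; ⊥-elim)
open import Data.List using (List)
open import Data.List.Relation.Unary.Any using (here; there)
open import Data.List.Membership.Propositional using (_∈_; lose; find)
open import Data.List.Membership.Propositional.Properties using (∈-++⁺ˡ; ∈-++⁺ʳ; ∈-++⁻)
open import Relation.Binary.PropositionalEquality using (_≡_; refl; sym; cong; subst)
open import Relation.Binary.Definitions using (tri<; tri≈; tri>)
open import Relation.Nullary using (¬_)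

∸≤⇒≤+ : ∀ {m n o} → m ∸ n ≤ o → m ≤ n + o
∸≤⇒≤+ {m} {n} m∸n≤o = ≤-trans (m≤n+m∸n m n) (+-monoʳ-≤ n m∸n≤o)

∸<⇒<+ : ∀ {m n o} → m ∸ n < o → m < n + o
∸<⇒<+ {m} {n} {o} m∸n<o = begin-strict
  m           ≤⟨ m≤n+m∸n m n ⟩
  n + (m ∸ n) <⟨ +-monoʳ-< n m∸n<o ⟩
  n + o       ∎
  where open ≤-Reasoning

<+⇒∸< : ∀ {m n o} → n ≤ m → m < n + o → m ∸ n < o
<+⇒∸< {m} {n} {o} n≤m m<n+o = ≤-trans (∸-monoˡ-< m<n+o n≤m) (≤-reflexive (m+n∸m≡n n o))

∸+∸≤⇒<+ : ∀ {a x b y r} → (a ∸ x) + (b ∸ y) ≤ r → x < a → b < y + r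
∸+∸≤⇒<+ {a} {x} {b} {y} {r} sum≤r x<a = ∸<⇒<+ (begin-strict
  b ∸ y             <⟨ m<n+m (b ∸ y) (m<n⇒0<n∸m x<a) ⟩
  (a ∸ x) + (b ∸ y) ≤⟨ sum≤r ⟩
  r                 ∎)
  where open ≤-Reasoning

Dist∞-bounds : ∀ {x y a b d} → Dist∞ (x , y) (a , b) d → a ≤ x + d × b ≤ y + d
Dist∞-bounds {x} {y} {a} {b} (_ , _ , refl) =
  ∸≤⇒≤+ (m≤n⊔m (b ∸ y) (a ∸ x)) , ∸≤⇒≤+ (m≤m⊔n (b ∸ y) (a ∸ x))

Dist∞⇒InBox : ∀ {x y a b d} → Dist∞ (x , y) (a , b) d → InBox a b d (x , y)
Dist∞⇒InBox {x} {y} {d = d} dist@(x≤a , y≤b , _) with Dist∞-bounds dist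
... | a≤x+d , b≤y+d =
  ≤-trans a≤x+d (+-monoʳ-≤ x d≤5d) , x≤a , ≤-trans b≤y+d (+-monoʳ-≤ y d≤5d) , y≤b
  where
  d≤5d : d ≤ 5 * d
  d≤5d = m≤m+n d (4 * d)

shared-edge-bounds : ∀ {v t ρ : ℕ → ℕ} i j e → EdgeInQ v t ρ i e → EdgeInQ v t ρ j e →
                     t i < t j + ρ i × v i < v j + ρ i × v j ≤ v i + ρ j
shared-edge-bounds {v} {t} {ρ} i j (H a b)
  ((_ , _ , Dᵢ) , (a<vᵢ , _ , _)) ((_ , b≤tⱼ , Dⱼ) , (a<vⱼ , _ , _)) =
  <-≤-trans (∸+∸≤⇒<+ Dᵢ a<vᵢ) (+-monoˡ-≤ (ρ i) b≤tⱼ) ,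
  ≤-<-trans (∸≤⇒≤+ (m+n≤o⇒m≤o (v i ∸ a) Dᵢ)) (+-monoˡ-< (ρ i) a<vⱼ) ,
  ≤-trans (∸≤⇒≤+ (m+n≤o⇒m≤o (v j ∸ a) Dⱼ)) (+-monoˡ-≤ (ρ j) (<⇒≤ a<vᵢ))
shared-edge-bounds {v} {t} {ρ} i j (V a b)
  ((a≤vᵢ , _ , Dᵢ) , (_ , b<tᵢ , _)) ((a≤vⱼ , _ , Dⱼ) , (_ , b<tⱼ , _)) =
  ≤-<-trans (∸≤⇒≤+ (m+n≤o⇒n≤o (v i ∸ a) Dᵢ)) (+-monoˡ-< (ρ i) b<tⱼ) ,
  <-≤-trans (∸+∸≤⇒<+ (≤-trans (≤-reflexive (+-comm (t i ∸ b) (v i ∸ a))) Dᵢ) b<tᵢ)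
            (+-monoˡ-≤ (ρ i) a≤vⱼ) ,
  ≤-trans (∸≤⇒≤+ (m+n≤o⇒m≤o (v j ∸ a) Dⱼ)) (+-monoˡ-≤ (ρ j) a≤vᵢ)

Endpoint : Edge → Replica → Set
Endpoint e q = tailE e ≡ q ⊎ headE e ≡ q

OnSeg : Seg → Replica → Set
OnSeg B q = Σ Edge λ e → EdgeIn e B × Endpoint e q

InF-∈ : ∀ {L B q} → B ∈ L → OnSeg B q → InF L q
InF-∈ B∈L (e , e∈B , end) = inj₂ (e , lose B∈L e∈B , end)

InF-cases : ∀ {L q} → InF L q → q ≡ (0 , 0) ⊎ Σ Seg λ B → B ∈ L × OnSeg B q
InF-cases (inj₁ q≡0) = inj₁ q≡0
InF-cases (inj₂ (e , e∈L , end)) with find e∈L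
... | B , B∈L , e∈B = inj₂ (B , B∈L , e , e∈B , end)

onVert⁻ : ∀ {c a b x y} → OnSeg (vert c a b) (x , y) → x ≡ c × a ≤ y × y ≤ b
onVert⁻ (V _ _ , (refl , a≤y , y<b) , inj₁ refl) = refl , a≤y , <⇒≤ y<b
onVert⁻ (V _ _ , (refl , a≤y , y<b) , inj₂ refl) = refl , m≤n⇒m≤1+n a≤y , y<b

onHoriz⁻ : ∀ {c a b x y} → OnSeg (horiz c a b) (x , y) → y ≡ c × a ≤ x × x ≤ b
onHoriz⁻ (H _ _ , (refl , a≤x , x<b) , inj₁ refl) = refl , a≤x , <⇒≤ x<b
onHoriz⁻ (H _ _ , (refl , a≤x , x<b) , inj₂ refl) = refl , m≤n⇒m≤1+n a≤x , x<b

onVert-bottom : ∀ {c a b} → a < b → OnSeg (vert c a b) (c , a)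
onVert-bottom {c} {a} a<b = V c a , (refl , ≤-refl , a<b) , inj₁ refl

onVert⁺ : ∀ {c a b y} → a < y → y ≤ b → OnSeg (vert c a b) (c , y)
onVert⁺ {c} {y = suc y} (s≤s a≤y) y<b = V c y , (refl , a≤y , y<b) , inj₂ refl

onHoriz⁺ : ∀ {c a b x} → a < x → x ≤ b → OnSeg (horiz c a b) (x , c)
onHoriz⁺ {c} {x = suc x} (s≤s a≤x) x<b = H x c , (refl , a≤x , x<b) , inj₂ refl

module Trace (v t u s ρ : ℕ → ℕ) where

  F : ℕ → List Seg
  F = Fmid v t u s ρ

  step : ℕ → List Seg
  step = stepSegs v t u s ρ

  ∈-Fpre⁺ : ∀ {B k m} → k < m → B ∈ step k → B ∈ Fpre v t u s ρ m
  ∈-Fpre⁺ {m = suc m} k<1+m B∈k with m≤n⇒m<n∨m≡n (≤-pred k<1+m)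
  ... | inj₁ k<m = ∈-++⁺ˡ (∈-Fpre⁺ k<m B∈k)
  ... | inj₂ refl = ∈-++⁺ʳ (Fpre v t u s ρ m) B∈k

  ∈-Fpre⁻ : ∀ {B} m → B ∈ Fpre v t u s ρ m → ∃ λ k → k < m × B ∈ step k
  ∈-Fpre⁻ (suc m) B∈F with ∈-++⁻ (Fpre v t u s ρ m) B∈F
  ... | inj₂ B∈m = m , n<1+n m , B∈m
  ... | inj₁ B∈Fpre with ∈-Fpre⁻ m B∈Fpre
  ...   | k , k<m , B∈k = k , m<n⇒m<1+n k<m , B∈k

  step-in-F : ∀ {B k i q} → k < i → B ∈ step k → OnSeg B q → InF (F i) q
  step-in-F k<i B∈k = InF-∈ (∈-++⁺ˡ (∈-Fpre⁺ k<i B∈k))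

  step-block-left-of-u : ∀ {B k x y} → B ∈ step k → OnSeg B (x , y) → x < u k → B ≡ sq1 t k
  step-block-left-of-u (here refl) _ _ = refl
  step-block-left-of-u (there (here refl)) onB x<u with onVert⁻ onB
  ... | refl , _ = ⊥-elim (<-irrefl refl x<u)
  step-block-left-of-u (there (there (here refl))) onB x<u with onHoriz⁻ onB
  ... | _ , u≤x , _ = ⊥-elim (<⇒≱ x<u u≤x)
  step-block-left-of-u (there (there (there (here refl)))) onB x<u with onVert⁻ onB
  ... | refl , _ = ⊥-elim (<-irrefl refl x<u)

  -- The SQ4 column and row may both be empty; the SQ5 column, nonempty as ρ(j) > 0, covers (u_j, t_j).
  request-row-in-F : ∀ {j i x} → j < i → 0 < ρ j → u j ≤ x → x ≤ v j → InF (F i) (x , t j)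
  request-row-in-F {j} j<i 0<ρ u≤x x≤v with m≤n⇒m<n∨m≡n u≤x
  ... | inj₁ u<x = step-in-F j<i (there (there (here refl))) (onHoriz⁺ u<x x≤v)
  ... | inj₂ refl =
    step-in-F j<i (there (there (there (here refl)))) (onVert-bottom (m<m+n (t j) 0<4ρ))
    where
    0<4ρ : 0 < 4 * ρ j
    0<4ρ = ≤-trans 0<ρ (m≤n*m (ρ j) 4)

  module Run {N : ℕ} (t-step : ∀ k → suc k < N → t k ≤ t (suc k))
             (run : ValidRun N v t u s ρ) where

    t-mono : ∀ {a b} → a ≤ b → b < N → t a ≤ t b
    t-mono {b = zero} z≤n _ = ≤-refl
    t-mono {a} {suc b} a≤1+b 1+b<N with m≤n⇒m<n∨m≡n a≤1+b
    ... | inj₁ a<1+b = ≤-trans (t-mono (≤-pred a<1+b) (<-trans (n<1+n b) 1+b<N)) (t-step b 1+b<N)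
    ... | inj₂ refl = ≤-refl

    ρ-attained : ∀ {k} → k < N → Σ Replica λ q → InF (F k) q × Dist∞ q (v k , t k) (ρ k)
    ρ-attained k<N with run _ k<N
    ... | attained , _ = attained

    ρ-minimal : ∀ {k q d} → k < N → InF (F k) q → Dist∞ q (v k , t k) d → ρ k ≤ d
    ρ-minimal k<N with run _ k<N
    ... | _ , minimal , _ = minimal _ _

    u≤v : ∀ {k} → k < N → u k ≤ v k
    u≤v k<N with run _ k<N
    ... | _ , _ , _ , (_ , u≤v , _) , _ = u≤v

    u-minimal : ∀ {k x y} → k < N → InF (F k) (x , y) → InBox (v k) (t k) (ρ k) (x , y) → u k ≤ x
    u-minimal k<N with run _ k<N
    ... | _ , _ , _ , _ , minimal = minimal _ _

    no-replica-within-ρ : ∀ {i x y} → i < N → InF (F i) (x , y) →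
                          x ≤ v i → y ≤ t i → v i < x + ρ i → t i < y + ρ i → ⊥
    no-replica-within-ρ i<N q∈F x≤v y≤t v<x+ρ t<y+ρ =
      <-irrefl refl (≤-<-trans (ρ-minimal i<N q∈F (x≤v , y≤t , refl))
                               (⊔-lub (<+⇒∸< y≤t t<y+ρ) (<+⇒∸< x≤v v<x+ρ)))

    late-sq1-above-row : ∀ {j k x y} → j < k → k < N → OnSeg (sq1 t k) (x , y) → t j ≤ y
    late-sq1-above-row {k = suc k} j<1+k 1+k<N onB with onVert⁻ onB
    ... | _ , tₖ≤y , _ = ≤-trans (t-mono (≤-pred j<1+k) (<-trans (n<1+n k) 1+k<N)) tₖ≤y

    late-block-reaches-row : ∀ {B j k x y} → j < k → k < N → B ∈ step k → OnSeg B (x , y) → y < t j →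
                             OnSeg (vert (u k) (s k) (t k)) (x , t j)
    late-block-reaches-row j<k k<N (here refl) onB y<t =
      ⊥-elim (<⇒≱ y<t (late-sq1-above-row j<k k<N onB))
    late-block-reaches-row j<k k<N (there (here refl)) onB y<t with onVert⁻ onB
    ... | refl , s≤y , _ = onVert⁺ (≤-<-trans s≤y y<t) (t-mono (<⇒≤ j<k) k<N)
    late-block-reaches-row j<k k<N (there (there (here refl))) onB y<t with onHoriz⁻ onB
    ... | refl , _ = ⊥-elim (<⇒≱ y<t (t-mono (<⇒≤ j<k) k<N))
    late-block-reaches-row j<k k<N (there (there (there (here refl)))) onB y<t with onVert⁻ onB
    ... | _ , tₖ≤y , _ = ⊥-elim (<⇒≱ y<t (≤-trans (t-mono (<⇒≤ j<k) k<N) tₖ≤y))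

    replica-of-earlier-F : ∀ {j i x y} → j < i → i < N → x < u j → y < t j →
                           ¬ InF (F i) (x , t j) → InF (F i) (x , y) → InF (F j) (x , y)
    replica-of-earlier-F {j} {i} j<i i<N x<u y<t row∉F q∈F with InF-cases q∈F
    ... | inj₁ q≡0 = inj₁ q≡0
    ... | inj₂ (B , B∈F , onB) with ∈-++⁻ (Fpre v t u s ρ i) B∈F
    ...   | inj₂ (here refl) = ⊥-elim (<⇒≱ y<t (late-sq1-above-row j<i i<N onB))
    ...   | inj₁ B∈Fpre with ∈-Fpre⁻ i B∈Fpre
    ...     | k , k<i , B∈k with <-cmp k j
    ...       | tri< k<j _ _ = step-in-F k<j B∈k onB
    ...       | tri≈ _ refl _ =
      InF-∈ (∈-++⁺ʳ (Fpre v t u s ρ j) (here (step-block-left-of-u B∈k onB x<u))) onB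
    ...       | tri> _ _ j<k = ⊥-elim (row∉F (step-in-F k<i (there (here refl))
                                (late-block-reaches-row j<k (<-trans k<i i<N) B∈k onB y<t)))

    v-left-of-earlier-u : ∀ {j i} → j < i → i < N → 0 < ρ i → 0 < ρ j →
                   t i < t j + ρ i → v i < v j + ρ i → v i < u j
    v-left-of-earlier-u {j} {i} j<i i<N 0<ρᵢ 0<ρⱼ tᵢ<tⱼ+ρᵢ vᵢ<vⱼ+ρᵢ = ≰⇒> λ uⱼ≤vᵢ →
      no-replica-within-ρ i<N
        (request-row-in-F j<i 0<ρⱼ (⊓-glb uⱼ≤vᵢ (u≤v (<-trans j<i i<N))) (m⊓n≤n (v i) (v j)))
        (m⊓n≤m (v i) (v j)) (t-mono (<⇒≤ j<i) i<N) vᵢ<row+ρᵢ tᵢ<tⱼ+ρᵢ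
      where
      vᵢ<row+ρᵢ : v i < v i ⊓ v j + ρ i
      vᵢ<row+ρᵢ = subst (v i <_) (sym (+-distribʳ-⊓ (ρ i) (v i) (v j)))
                        (⊓-glb (m<m+n (v i) 0<ρᵢ) vᵢ<vⱼ+ρᵢ)

    ρ-grows-fourfold : ∀ {j i} → j < i → i < N → Uncovered v u ρ i →
               t i < t j + ρ i → v j ≤ v i + ρ j → v i < u j → 4 * ρ j ≤ ρ i
    ρ-grows-fourfold {j} {i} j<i i<N uncᵢ tᵢ<tⱼ+ρᵢ vⱼ≤vᵢ+ρⱼ vᵢ<uⱼ with ρ-attained i<N
    ... | (x , y) , q∈F , dist@(x≤vᵢ , y≤tᵢ , _) =
      ≮⇒≥ λ ρᵢ<4ρⱼ → <⇒≱ (≤-<-trans x≤vᵢ vᵢ<uⱼ) (uⱼ≤x ρᵢ<4ρⱼ)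
      where
      tⱼ≤tᵢ : t j ≤ t i
      tⱼ≤tᵢ = t-mono (<⇒≤ j<i) i<N

      vᵢ<x+ρᵢ : v i < x + ρ i
      vᵢ<x+ρᵢ = ≤-trans (∸<⇒<+ uncᵢ) (+-monoˡ-≤ (ρ i) (u-minimal i<N q∈F (Dist∞⇒InBox dist)))

      row∉F : ¬ InF (F i) (x , t j)
      row∉F row∈F = no-replica-within-ρ i<N row∈F x≤vᵢ tⱼ≤tᵢ vᵢ<x+ρᵢ tᵢ<tⱼ+ρᵢ

      y<tⱼ : y < t j
      y<tⱼ = ≰⇒> λ tⱼ≤y →
        no-replica-within-ρ i<N q∈F x≤vᵢ y≤tᵢ vᵢ<x+ρᵢ (<-≤-trans tᵢ<tⱼ+ρᵢ (+-monoˡ-≤ (ρ i) tⱼ≤y))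

      q∈Fⱼ : InF (F j) (x , y)
      q∈Fⱼ = replica-of-earlier-F j<i i<N (≤-<-trans x≤vᵢ vᵢ<uⱼ) y<tⱼ row∉F q∈F

      uⱼ≤x : ρ i < 4 * ρ j → u j ≤ x
      uⱼ≤x ρᵢ<4ρⱼ = u-minimal (<-trans j<i i<N) q∈Fⱼ
        (vⱼ≤x+5ρⱼ , <⇒≤ (<-≤-trans (≤-<-trans x≤vᵢ vᵢ<uⱼ) (u≤v (<-trans j<i i<N))) ,
         tⱼ≤y+5ρⱼ , <⇒≤ y<tⱼ)
        where
        open ≤-Reasoning
        ρᵢ≤5ρⱼ : ρ i ≤ 5 * ρ j
        ρᵢ≤5ρⱼ = ≤-trans (<⇒≤ ρᵢ<4ρⱼ) (m≤n+m (4 * ρ j) (ρ j))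

        vⱼ≤x+5ρⱼ : v j ≤ x + 5 * ρ j
        vⱼ≤x+5ρⱼ = begin
          v j                 ≤⟨ vⱼ≤vᵢ+ρⱼ ⟩
          v i + ρ j           ≤⟨ +-monoˡ-≤ (ρ j) (<⇒≤ vᵢ<x+ρᵢ) ⟩
          x + ρ i + ρ j       ≤⟨ +-monoˡ-≤ (ρ j) (+-monoʳ-≤ x (<⇒≤ ρᵢ<4ρⱼ)) ⟩
          x + 4 * ρ j + ρ j   ≡⟨ +-assoc x (4 * ρ j) (ρ j) ⟩
          x + (4 * ρ j + ρ j) ≡⟨ cong (x +_) (+-comm (4 * ρ j) (ρ j)) ⟩
          x + 5 * ρ j         ∎

        tⱼ≤y+5ρⱼ : t j ≤ y + 5 * ρ j
        tⱼ≤y+5ρⱼ = begin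
          t j         ≤⟨ tⱼ≤tᵢ ⟩
          t i         ≤⟨ proj₂ (Dist∞-bounds dist) ⟩
          y + ρ i     ≤⟨ +-monoʳ-≤ y ρᵢ≤5ρⱼ ⟩
          y + 5 * ρ j ∎

lemma4 : (n N : ℕ) (v t : ℕ → ℕ) →
         (∀ k → k < N → v k ≤ n) →
         (∀ k → suc k < N → t k ≤ t (suc k)) →
         (u s ρ : ℕ → ℕ) → ValidRun N v t u s ρ →
         (i j : ℕ) → i < N → j < i →
         Uncovered v u ρ i → Uncovered v u ρ j →
         QNotEdgeDisjoint v t ρ i j →
         (4 * ρ j ≤ ρ i) × (v j ≤ v i + ρ j × v i < u j × u j ≤ v j)
lemma4 _ N v t _ t-step u s ρ run i j i<N j<i uncᵢ uncⱼ (e , e∈Qᵢ , e∈Qⱼ)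
  with shared-edge-bounds i j e e∈Qᵢ e∈Qⱼ
... | tᵢ<tⱼ+ρᵢ , vᵢ<vⱼ+ρᵢ , vⱼ≤vᵢ+ρⱼ =
  ρ-grows-fourfold j<i i<N uncᵢ tᵢ<tⱼ+ρᵢ vⱼ≤vᵢ+ρⱼ vᵢ<uⱼ , vⱼ≤vᵢ+ρⱼ , vᵢ<uⱼ , u≤v (<-trans j<i i<N)
  where
  open Trace v t u s ρ
  open Run t-step run
  vᵢ<uⱼ : v i < u j
  vᵢ<uⱼ = v-left-of-earlier-u j<i i<N (m<n⇒0<n uncᵢ) (m<n⇒0<n uncⱼ) tᵢ<tⱼ+ρᵢ vᵢ<vⱼ+ρᵢ
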